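{- Let $k\ge 3$, $m\ge 3$, $x\ge 1$ and $y\ge 0$ be integers with $k\nmid mx+ky$. Then a $(k,mx+ky)$-cleared oriented graph does not contain $\overrightarrow{C}_m$.
   Context: An oriented graph is a directed graph without loops in which every pair of vertices is joined by at most one arc. $\overrightarrow{C}_m$ denotes the directed cycle of length $m$; "contains" means contains a subgraph isomorphic to it. An oriented graph $G$ contains a homomorphic image of $\overrightarrow{C}_\ell$ if there is a map $\varphi:V(\overrightarrow{C}_\ell)\to V(G)$ sending arcs to arcs, i.e. $G$ contains a closed directed walk of length $\ell$. For integers $k,\ell\ge 3$ with $k\nmid\ell$, an oriented graph $G$ is $(k,\ell)$-cleared if it contains no homomorphic image of $\overrightarrow{C}_\ell$ and every arc and every vertex of $G$ lies in some copy of $\overrightarrow{C}_k$. -}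

module Defs where

open import Data.Nat using (ℕ; suc; NonZero; _%_)
open import Data.Nat.DivMod using (m%n<n)
open import Data.Fin using (Fin; toℕ; fromℕ<)
open import Data.Product using (Σ; ∃; ∃-syntax; _×_; _,_)
open import Data.Empty using (⊥)
open import Relation.Nullary using (¬_)
open import Relation.Binary.PropositionalEquality using (_≡_)
open import Function.Definitions using (Injective)
open import Level using (0ℓ; suc)

next : ∀ {m} .{{_ : NonZero m}} → Fin m → Fin m
next {m} i = fromℕ< (m%n<n (ℕ.suc (toℕ i)) m)

record OrientedGraph : Set₁ where
  field
    n     : ℕ
    Arc   : Fin n → Fin n → Set
    loopless   : ∀ u → ¬ Arc u u
    oriented   : ∀ u v → Arc u v → ¬ Arc v u

open OrientedGraph public

IsCycleHom : (G : OrientedGraph) (ℓ : ℕ) .{{_ : NonZero ℓ}} → (Fin ℓ → Fin (n G)) → Set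
IsCycleHom G ℓ c = ∀ i → Arc G (c i) (c (next i))

HasHomImageCycle : OrientedGraph → (ℓ : ℕ) .{{_ : NonZero ℓ}} → Set
HasHomImageCycle G ℓ = Σ (Fin ℓ → Fin (n G)) λ c → IsCycleHom G ℓ c

IsCycleCopy : (G : OrientedGraph) (m : ℕ) .{{_ : NonZero m}} → (Fin m → Fin (n G)) → Set
IsCycleCopy G m c = Injective _≡_ _≡_ c × IsCycleHom G m c

ContainsCycle : OrientedGraph → (m : ℕ) .{{_ : NonZero m}} → Set
ContainsCycle G m = Σ (Fin m → Fin (n G)) λ c → IsCycleCopy G m c

-- (k,ℓ)-cleared (the hypothesis k ∤ ℓ is imposed in the theorem)
Cleared : (k ℓ : ℕ) .{{_ : NonZero k}} .{{_ : NonZero ℓ}} → OrientedGraph → Set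
Cleared k ℓ G =
  ¬ HasHomImageCycle G ℓ
  × (∀ u v → Arc G u v →
       Σ (Fin k → Fin (n G)) λ c → IsCycleCopy G k c × Σ (Fin k) λ i → (c i ≡ u) × (c (next i) ≡ v))
  × (∀ u → Σ (Fin k → Fin (n G)) λ c → IsCycleCopy G k c × Σ (Fin k) λ i → c i ≡ u)

{-# OPTIONS --safe #-}
-- Going x times around the given copy of C_m and then y times around a copy of C_k
-- through one of its vertices is a closed walk of length mx + ky, which a cleared graph
-- cannot contain.
module Submission where

open import Defs
open import Data.Nat using (ℕ; _+_; _*_; _≤_; NonZero)
open import Data.Nat.Divisibility using (_∣_)
open import Relation.Nullary using (¬_)

open import Level using (Level; _⊔_)
open import Data.Nat using (zero; suc; _<_; _%_; s<s⁻¹; >-nonZero⁻¹)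
open import Data.Nat.Properties using (+-identityʳ; +-suc; *-comm; m≤n⇒m<n∨m≡n)
open import Data.Nat.DivMod using (m%n<n; m%n%n≡m%n; %-distribˡ-+; [m+n]%n≡m%n; m<n⇒m%n≡m; n%n≡0)
open import Data.Fin using (Fin; toℕ; fromℕ<)
open import Data.Fin.Properties using (toℕ-fromℕ<; toℕ-injective; toℕ<n)
open import Data.Product using (Σ; _,_)
open import Data.Sum using (inj₁; inj₂)
open import Relation.Binary.PropositionalEquality
  using (_≡_; refl; sym; trans; cong; cong₂; subst; module ≡-Reasoning)
open ≡-Reasoning

private variable
  a r : Level
  m ℓ j : ℕ

[m%d+n]%d≡[m+n]%d : ∀ m n d .{{_ : NonZero d}} → (m % d + n) % d ≡ (m + n) % d
[m%d+n]%d≡[m+n]%d m n d = begin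
  (m % d + n) % d         ≡⟨ %-distribˡ-+ (m % d) n d ⟩
  (m % d % d + n % d) % d ≡⟨ cong (λ t → (t + n % d) % d) (m%n%n≡m%n m d) ⟩
  (m % d + n % d) % d     ≡⟨ %-distribˡ-+ m n d ⟨
  (m + n) % d             ∎

module _ .{{_ : NonZero m}} where

  toℕ-next : ∀ i → toℕ (next i) ≡ suc (toℕ i) % m
  toℕ-next i = toℕ-fromℕ< (m%n<n (suc (toℕ i)) m)

  advance : Fin m → ℕ → Fin m
  advance i zero    = i
  advance i (suc j) = advance (next i) j

  toℕ-advance : ∀ i j → toℕ (advance i j) ≡ (toℕ i + j) % m
  toℕ-advance i zero = sym (trans (cong (_% m) (+-identityʳ (toℕ i))) (m<n⇒m%n≡m (toℕ<n i)))
  toℕ-advance i (suc j) = begin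
    toℕ (advance (next i) j)  ≡⟨ toℕ-advance (next i) j ⟩
    (toℕ (next i) + j) % m    ≡⟨ cong (λ t → (t + j) % m) (toℕ-next i) ⟩
    (suc (toℕ i) % m + j) % m ≡⟨ [m%d+n]%d≡[m+n]%d (suc (toℕ i)) j m ⟩
    (suc (toℕ i) + j) % m     ≡⟨ cong (_% m) (+-suc (toℕ i) j) ⟨
    (toℕ i + suc j) % m       ∎

  advance-period : ∀ i → advance i m ≡ i
  advance-period i = toℕ-injective (begin
    toℕ (advance i m) ≡⟨ toℕ-advance i m ⟩
    (toℕ i + m) % m   ≡⟨ [m+n]%n≡m%n (toℕ i) m ⟩
    toℕ i % m         ≡⟨ m<n⇒m%n≡m (toℕ<n i) ⟩
    toℕ i             ∎)

data Walk {A : Set a} (R : A → A → Set r) : A → A → ℕ → Set (a ⊔ r) where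
  []  : ∀ {u} → Walk R u u 0
  _∷_ : ∀ {u v w ℓ} → R u v → Walk R v w ℓ → Walk R u w (suc ℓ)

module _ {A : Set a} {R : A → A → Set r} where

  private variable
    u v w : A

  _++_ : Walk R u v m → Walk R v w ℓ → Walk R u w (m + ℓ)
  []      ++ q = q
  (e ∷ p) ++ q = e ∷ (p ++ q)

  repeat : ∀ t → Walk R u u ℓ → Walk R u u (t * ℓ)
  repeat zero    p = []
  repeat (suc t) p = p ++ repeat t p

  -- Vertex reached after j steps; beyond the end of the walk it stays at the last vertex.
  _!_ : Walk R u v ℓ → ℕ → A
  _!_ {u = u} p zero = u
  _!_ {u = u} [] (suc j) = u
  (e ∷ p) ! suc j = p ! j

  !-step : (p : Walk R u v ℓ) → ∀ {j} → j < ℓ → R (p ! j) (p ! suc j)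
  !-step (e ∷ p) {zero}  _   = e
  !-step (e ∷ p) {suc j} j<ℓ = !-step p (s<s⁻¹ j<ℓ)

  !-end : (p : Walk R u v ℓ) → p ! ℓ ≡ v
  !-end []      = refl
  !-end (e ∷ p) = !-end p

  !-mod : .{{_ : NonZero ℓ}} (p : Walk R u u ℓ) → j ≤ ℓ → p ! (j % ℓ) ≡ p ! j
  !-mod p j≤ℓ with m≤n⇒m<n∨m≡n j≤ℓ
  ... | inj₁ j<ℓ  = cong (p !_) (m<n⇒m%n≡m j<ℓ)
  ... | inj₂ refl = trans (cong (p !_) (n%n≡0 _)) (sym (!-end p))

  closedWalk⇒cycleHom : .{{_ : NonZero ℓ}} → Walk R u u ℓ →
                        Σ (Fin ℓ → A) λ c → ∀ i → R (c i) (c (next i))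
  closedWalk⇒cycleHom p = (λ i → p ! toℕ i) , λ i →
    subst (R (p ! toℕ i))
          (sym (trans (cong (p !_) (toℕ-next i)) (!-mod p (toℕ<n i))))
          (!-step p (toℕ<n i))

  module _ .{{_ : NonZero m}} {c : Fin m → A} (hom : ∀ i → R (c i) (c (next i))) where

    walkAlong : ∀ i j → Walk R (c i) (c (advance i j)) j
    walkAlong i zero    = []
    walkAlong i (suc j) = hom i ∷ walkAlong (next i) j

    cycleHom⇒closedWalk : ∀ {i u} → c i ≡ u → Walk R u u m
    cycleHom⇒closedWalk {i} refl =
      subst (λ v → Walk R (c i) v m) (cong c (advance-period i)) (walkAlong i m)

mainTheorem18 : (k m x y : ℕ) → 3 ≤ k → 3 ≤ m → 1 ≤ x →
    ¬ (k ∣ m * x + k * y) →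
    .{{_ : NonZero k}} .{{_ : NonZero m}} .{{_ : NonZero (m * x + k * y)}} →
    (G : OrientedGraph) → Cleared k (m * x + k * y) G → ¬ ContainsCycle G m
mainTheorem18 k m x y _ _ _ _ G (noClosedWalk , _ , onCopyOfCk) (c , _ , cHom) =
  noClosedWalk (closedWalk⇒cycleHom
    (subst (Walk (Arc G) u u) (cong₂ _+_ (*-comm x m) (*-comm y k)) combined))
  where
  u : Fin (n G)
  u = c (fromℕ< (>-nonZero⁻¹ m))

  aroundCk : Walk (Arc G) u u k
  aroundCk with onCopyOfCk u
  ... | _ , (_ , dHom) , _ , dj≡u = cycleHom⇒closedWalk dHom dj≡u

  combined : Walk (Arc G) u u (x * m + y * k)
  combined = repeat x (cycleHom⇒closedWalk cHom refl) ++ repeat y aroundCk
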